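{- For every class $[\widehat{\mathbf{c}}]\in\mathrm{Rec}(G,\sim_s)$ we have $\mathrm{slvl}([\widehat{\mathbf{c}}])=\mathrm{dlvl}([\widehat{\mathbf{c}}])$.
   Context: Let $G=(V,E)$ be a finite strongly connected digraph and $s\in V$. Sinkless sandpile model: configurations $\mathbf{c}\in\mathbb{N}_0^V$, firing $v$ sends one chip along each outgoing edge of $v$, legal if $\mathbf{c}(v)\ge\deg^+_G(v)$; $\mathbf{c}$ is recurrent if unstable and every configuration reachable from $\mathbf{c}$ by legal firings can reach $\mathbf{c}$ back. Sandpile model with sink $s$: $s$-configurations $\widehat{\mathbf{c}}\in\mathbb{N}_0^{V\setminus\{s\}}$, $s$ never fires and chips sent to $s$ are lost; $\widehat{\mathbf{c}}^\circ$ is the stabilization; $\widehat{\mathbf{c}}$ is $s$-recurrent if for every $\widehat{\mathbf{c}}_1$ some $\widehat{\mathbf{c}}_2$ gives $(\widehat{\mathbf{c}}_1+\widehat{\mathbf{c}}_2)^\circ=\widehat{\mathbf{c}}$. With $\mathbf{u}_s(v)$ the number of edges $s\to v$, $\widehat{\mathbf{c}}\sim_s\widehat{\mathbf{d}}$ iff $\widehat{\mathbf{d}}=(\widehat{\mathbf{c}}+k\mathbf{u}_s)^\circ$ for some $k\in\mathbb{N}_0$, and $\mathrm{Rec}(G,\sim_s)$ is the set of classes of $s$-recurrent configurations. For an $s$-configuration $\widehat{\mathbf{c}}$, $\overline{\mathbf{c}}$ extends it by $0$ at $s$, $\mathbf{1}_s$ is the indicator of $s$, $\chi(\widehat{\mathbf{c}})$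 is the least $k$ with $\overline{\mathbf{c}}+k\mathbf{1}_s$ recurrent, and the $s$-level $\mathrm{slvl}(\widehat{\mathbf{c}})=\chi(\widehat{\mathbf{c}})+\sum_{v\ne s}\widehat{\mathbf{c}}(v)$ is constant on $\sim_s$-classes, defining $\mathrm{slvl}([\widehat{\mathbf{c}}])$. The d-level is $\mathrm{dlvl}(\widehat{\mathbf{c}})=\deg^+_G(s)+\sum_{v\ne s}\widehat{\mathbf{c}}(v)$, and $\mathrm{dlvl}([\widehat{\mathbf{c}}])=\max_{\widehat{\mathbf{c}}'\in[\widehat{\mathbf{c}}]}\mathrm{dlvl}(\widehat{\mathbf{c}}')$. -}

module Defs where

open import Data.Nat using (ℕ; zero; suc; _+_; _*_; _∸_; _≤_; _<_)
open import Data.Fin using (Fin; _≟_)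
open import Data.List using (List; map; allFin)
open import Data.Nat.ListAction using (sum)
open import Data.Product using (Σ; Σ-syntax; ∃; ∃-syntax; _×_; _,_)
open import Data.Bool using (if_then_else_)
open import Relation.Nullary using (¬_; does)
open import Relation.Binary.PropositionalEquality using (_≡_; _≢_)
open import Relation.Binary.Construct.Closure.ReflexiveTransitive using (Star)

-- A finite directed multigraph on the vertex set Fin n:
-- E u v = number of edges u → v.

Config : ℕ → Set
Config n = Fin n → ℕ

module Sandpile {n : ℕ} (E : Fin n → Fin n → ℕ) where

  data Path : Fin n → Fin n → Set where
    here  : ∀ {u} → Path u u
    there : ∀ {u w v} → 0 < E u w → Path w v → Path u v

  StronglyConnected : Set
  StronglyConnected = ∀ u v → Path u v

  Σall : (Fin n → ℕ) → ℕ
  Σall f = sum (map f (allFin n))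

  Σoff : Fin n → (Fin n → ℕ) → ℕ
  Σoff s f = Σall (λ v → if does (v ≟ s) then 0 else f v)

  outdeg : Fin n → ℕ
  outdeg v = Σall (E v)

  -- result of firing v in c (meaningful when c v ≥ outdeg v)
  fire : Config n → Fin n → Config n
  fire c v w = (c w ∸ (if does (w ≟ v) then outdeg v else 0)) + E v w

  _⊕_ : Config n → Config n → Config n
  (c ⊕ d) v = c v + d v

  Step : Config n → Config n → Set
  Step c d = Σ[ v ∈ Fin n ] (outdeg v ≤ c v × (∀ w → d w ≡ fire c v w))

  Reach : Config n → Config n → Set
  Reach = Star Step

  Unstable : Config n → Set
  Unstable c = ∃[ v ] (outdeg v ≤ c v)

  Recurrent : Config n → Set
  Recurrent c = Unstable c × (∀ d → Reach c d → Reach d c)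

  -- Sandpile model with sink s.
  -- An s-configuration is represented by a Config n whose value at s is
  -- ignored; two s-configurations are equal iff they agree off s.

  _≈[_]_ : Config n → Fin n → Config n → Set
  c ≈[ s ] d = ∀ v → v ≢ s → c v ≡ d v

  SStep : Fin n → Config n → Config n → Set
  SStep s c d = Σ[ v ∈ Fin n ] (v ≢ s × outdeg v ≤ c v × (d ≈[ s ] fire c v))

  SReach : Fin n → Config n → Config n → Set
  SReach s = Star (SStep s)

  SStable : Fin n → Config n → Set
  SStable s d = ∀ v → v ≢ s → d v < outdeg v

  Stab : Fin n → Config n → Config n → Set
  Stab s c d = Σ[ e ∈ Config n ] (SReach s c e × SStable s e × (e ≈[ s ] d))

  SRecurrent : Fin n → Config n → Set
  SRecurrent s c = ∀ (c₁ : Config n) → ∃[ c₂ ] Stab s (c₁ ⊕ c₂) c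

  ku : Fin n → ℕ → Config n
  ku s k v = k * E s v

  Equiv : Fin n → Config n → Config n → Set
  Equiv s c d = ∃[ k ] Stab s (c ⊕ ku s k) d

  extAdd : Fin n → Config n → ℕ → Config n
  extAdd s c k v = if does (v ≟ s) then k else c v

  IsChi : Fin n → Config n → ℕ → Set
  IsChi s c k = Recurrent (extAdd s c k) × (∀ j → j < k → ¬ Recurrent (extAdd s c j))

  dlvl : Fin n → Config n → ℕ
  dlvl s c = outdeg s + Σoff s c

module Submission where

-- Let T add u_s and stabilize. The class of c is its T-orbit, which is periodic, so its
-- d-levels attain a maximum M, at some d = Tⁱ c. Putting M − Σ c chips on the sink of c̄, one
-- may repeatedly fire the sink and stabilize: this walks along the orbit of c, keeps the total
-- M, and after one period returns, so by strong connectivity the configuration is recurrent.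
-- Conversely, if c̄ + j·1_s is recurrent it can mimic the stabilization of c + k·u_s (unstable
-- non-sink vertices must fire there anyway, and when none is left recurrence forces the sink
-- to fire, adding one u_s), ending at a recurrent configuration that equals d off the sink;
-- its sink is then unstable, so j + Σ c ≥ deg⁺ s + Σ d. Hence χ(c) = M − Σ c.

open import Data.Bool using (if_then_else_)
open import Data.Empty using (⊥-elim)
open import Data.Fin using (Fin; _≟_; toℕ; fromℕ<; funToFin; finToFun)
  renaming (zero to fzero; suc to fsuc)
open import Data.Fin.Properties using (any?; pigeonhole; toℕ<n; toℕ-fromℕ<; finToFun-funToFin)
open import Data.List using (List; []; _∷_; _++_; length; map; allFin; tabulate; upTo)
open import Data.List.Extrema.Nat using (argmax; f[xs]≤f[argmax])
import Data.List.Membership.DecPropositional as DecMembership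
open import Data.List.Membership.Propositional using (_∈_; _∉_)
open import Data.List.Membership.Propositional.Properties using (∈-++⁺ʳ; ∈-upTo⁺)
open import Data.List.Properties using (map-cong; map-tabulate; length-++)
open import Data.List.Relation.Binary.Permutation.Propositional using (_↭_)
open import Data.List.Relation.Binary.Permutation.Propositional.Properties
  using (shift; ↭-length; All-resp-↭)
open import Data.List.Relation.Unary.All using (All; []; _∷_)
  renaming (tail to All-tail; lookup to All-lookup)
open import Data.List.Relation.Unary.All.Properties using () renaming (++⁺ to All-++⁺)
open import Data.List.Relation.Unary.Any using (here; there)
open import Data.Nat
  using (ℕ; zero; suc; _+_; _*_; _∸_; _^_; _≤_; _<_; _≤?_; z≤n; s≤s; NonZero; >-nonZero)
open import Data.Nat.DivMod using (_%_; _/_; m≡m%n+[m/n]*n; m%n<n)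
open import Data.Nat.GeneralisedArithmetic using (fold; fold-+)
open import Data.Nat.ListAction using (sum)
open import Data.Nat.Properties hiding (_≟_)
open import Data.Product using (∃; ∃₂; ∃-syntax; _×_; _,_; proj₁; proj₂)
open import Data.Sum using (_⊎_; inj₁; inj₂)
open import Data.Unit using (⊤; tt)
open import Function using (id; _∘_)
open import Level using (0ℓ)
open import Relation.Binary.Bundles using (Setoid)
open import Relation.Binary.Construct.Closure.ReflexiveTransitive using (ε; _◅_; _◅◅_)
open import Relation.Binary.PropositionalEquality
import Relation.Binary.Reasoning.Setoid as SetoidReasoning
open import Relation.Nullary using (¬_; Dec; does; yes; no)
open import Relation.Nullary.Decidable using (_×-dec_; ¬?)

open import Defs

open import Algebra.Properties.CommutativeMonoid.Sum +-0-commutativeMonoid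
  using (sum-replicate-zero; ∑-distrib-+) renaming (sum to ∑)
open import Algebra.Properties.CommutativeSemigroup +-commutativeSemigroup
  using (xy∙z≈xz∙y; x∙yz≈y∙xz)

sum-tabulate : ∀ {m} (f : Fin m → ℕ) → sum (tabulate f) ≡ ∑ f
sum-tabulate {zero}  f = refl
sum-tabulate {suc m} f = cong (f fzero +_) (sum-tabulate (f ∘ fsuc))

δ : ∀ {m} → Fin m → ℕ → Fin m → ℕ
δ v a x = if does (x ≟ v) then a else 0

∑-δ : ∀ {m} (v : Fin m) a → ∑ (δ v a) ≡ a
∑-δ {suc m} fzero    a = trans (cong (a +_) (sum-replicate-zero m)) (+-identityʳ a)
∑-δ {suc m} (fsuc v) a = ∑-δ v a

nonempty-∈ : ∀ {A : Set} {xs : List A} → 0 < length xs → ∃ (_∈ xs)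
nonempty-∈ {xs = x ∷ _} _ = x , here refl

module Firing {n : ℕ} (E : Fin n → Fin n → ℕ) where
  open Sandpile E public
  open DecMembership (_≟_ {n}) using (_∈?_)

  Σall≡∑ : (f : Fin n → ℕ) → Σall f ≡ ∑ f
  Σall≡∑ f = trans (cong sum (map-tabulate id f)) (sum-tabulate f)

  Σall-cong : ∀ {f g : Fin n → ℕ} → f ≗ g → Σall f ≡ Σall g
  Σall-cong f≗g = cong sum (map-cong f≗g (allFin n))

  Σall-+ : (f g : Fin n → ℕ) → Σall (λ x → f x + g x) ≡ Σall f + Σall g
  Σall-+ f g = begin
    Σall (λ x → f x + g x) ≡⟨ Σall≡∑ _ ⟩
    ∑ (λ x → f x + g x)    ≡⟨ ∑-distrib-+ f g ⟩
    ∑ f + ∑ g              ≡⟨ cong₂ _+_ (Σall≡∑ f) (Σall≡∑ g) ⟨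
    Σall f + Σall g        ∎
    where open ≡-Reasoning

  Σall-δ : ∀ v a → Σall (δ v a) ≡ a
  Σall-δ v a = trans (Σall≡∑ (δ v a)) (∑-δ v a)

  Σall-split : ∀ v (f : Fin n → ℕ) → Σall f ≡ f v + Σoff v f
  Σall-split v f = begin
    Σall f                                         ≡⟨ Σall-cong split ⟩
    Σall (λ x → δ v (f v) x + (if does (x ≟ v) then 0 else f x))
                                                   ≡⟨ Σall-+ _ _ ⟩
    Σall (δ v (f v)) + Σoff v f                    ≡⟨ cong (_+ Σoff v f) (Σall-δ v (f v)) ⟩
    f v + Σoff v f                                 ∎
    where
    open ≡-Reasoning
    split : ∀ x → f x ≡ δ v (f v) x + (if does (x ≟ v) then 0 else f x)
    split x with x ≟ v
    ... | yes refl = sym (+-identityʳ (f x))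
    ... | no _     = refl

  fire-≢ : ∀ c {v w} → w ≢ v → fire c v w ≡ c w + E v w
  fire-≢ c {v} {w} w≢v with w ≟ v
  ... | yes w≡v = ⊥-elim (w≢v w≡v)
  ... | no _    = refl

  -- Legality rules out truncation in the subtraction inside fire.
  fire-spec : ∀ {c v} → outdeg v ≤ c v → ∀ x → fire c v x + δ v (outdeg v) x ≡ c x + E v x
  fire-spec {c} {v} lv x with x ≟ v
  ... | yes refl = begin
    c x ∸ outdeg x + E x x + outdeg x  ≡⟨ xy∙z≈xz∙y (c x ∸ outdeg x) (E x x) (outdeg x) ⟩
    c x ∸ outdeg x + outdeg x + E x x  ≡⟨ cong (_+ E x x) (m∸n+n≡m lv) ⟩
    c x + E x x                        ∎
    where open ≡-Reasoning
  ... | no _ = +-identityʳ _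

  fire-≥ : ∀ c {v w} → w ≢ v → c w ≤ fire c v w
  fire-≥ c {v} {w} w≢v = subst (c w ≤_) (sym (fire-≢ c w≢v)) (m≤m+n (c w) (E v w))

  fire-≗ : ∀ {c c′} v → c ≗ c′ → fire c v ≗ fire c′ v
  fire-≗ v c≗c′ x = cong (λ z → z ∸ δ v (outdeg v) x + E v x) (c≗c′ x)

  fire-twice : ∀ {c v w} → outdeg v ≤ c v → outdeg w ≤ fire c v w → ∀ x →
    fire (fire c v) w x + (δ w (outdeg w) x + δ v (outdeg v) x) ≡ c x + E v x + E w x
  fire-twice {c} {v} {w} lv lw x = begin
    fire (fire c v) w x + (δw + δv)  ≡⟨ +-assoc (fire (fire c v) w x) δw δv ⟨
    fire (fire c v) w x + δw + δv    ≡⟨ cong (_+ δv) (fire-spec lw x) ⟩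
    fire c v x + E w x + δv          ≡⟨ xy∙z≈xz∙y (fire c v x) (E w x) δv ⟩
    fire c v x + δv + E w x          ≡⟨ cong (_+ E w x) (fire-spec lv x) ⟩
    c x + E v x + E w x              ∎
    where
    open ≡-Reasoning
    δv = δ v (outdeg v) x
    δw = δ w (outdeg w) x

  fire-comm : ∀ {c v w} → outdeg v ≤ c v → outdeg w ≤ c w →
              fire (fire c v) w ≗ fire (fire c w) v
  fire-comm {c} {v} {w} lv lw x with v ≟ w
  ... | yes refl = refl
  ... | no v≢w = +-cancelʳ-≡ (δ w (outdeg w) x + δ v (outdeg v) x) _ _ (begin
    fire (fire c v) w x + (δ w _ x + δ v _ x)  ≡⟨ fire-twice lv (≤-trans lw (fire-≥ c (v≢w ∘ sym))) x ⟩
    c x + E v x + E w x                        ≡⟨ xy∙z≈xz∙y (c x) (E v x) (E w x) ⟩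
    c x + E w x + E v x                        ≡⟨ fire-twice lw (≤-trans lv (fire-≥ c v≢w)) x ⟨
    fire (fire c w) v x + (δ v _ x + δ w _ x)  ≡⟨ cong (fire (fire c w) v x +_) (+-comm (δ v _ x) _) ⟩
    fire (fire c w) v x + (δ w _ x + δ v _ x)  ∎)
    where open ≡-Reasoning

  fire-⊕ : ∀ {c v} d → outdeg v ≤ c v → fire (c ⊕ d) v ≗ fire c v ⊕ d
  fire-⊕ {c} {v} d lv x = +-cancelʳ-≡ (δ v (outdeg v) x) _ _ (begin
    fire (c ⊕ d) v x + δ v _ x   ≡⟨ fire-spec (≤-trans lv (m≤m+n (c v) (d v))) x ⟩
    c x + d x + E v x            ≡⟨ xy∙z≈xz∙y (c x) (d x) (E v x) ⟩
    c x + E v x + d x            ≡⟨ cong (_+ d x) (fire-spec lv x) ⟨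
    fire c v x + δ v _ x + d x   ≡⟨ xy∙z≈xz∙y (fire c v x) (δ v _ x) (d x) ⟩
    fire c v x + d x + δ v _ x   ∎)
    where open ≡-Reasoning

  Σall-fire : ∀ {c v} → outdeg v ≤ c v → Σall (fire c v) ≡ Σall c
  Σall-fire {c} {v} lv = +-cancelʳ-≡ (outdeg v) _ _ (begin
    Σall (fire c v) + outdeg v                     ≡⟨ cong (Σall (fire c v) +_) (Σall-δ v (outdeg v)) ⟨
    Σall (fire c v) + Σall (δ v (outdeg v))        ≡⟨ Σall-+ (fire c v) (δ v (outdeg v)) ⟨
    Σall (λ x → fire c v x + δ v (outdeg v) x)     ≡⟨ Σall-cong (fire-spec lv) ⟩
    Σall (λ x → c x + E v x)                       ≡⟨ Σall-+ c (E v) ⟩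
    Σall c + outdeg v                              ∎)
    where open ≡-Reasoning

  Legal : Config n → List (Fin n) → Set
  Legal c []      = ⊤
  Legal c (v ∷ σ) = outdeg v ≤ c v × Legal (fire c v) σ

  run : Config n → List (Fin n) → Config n
  run c []      = c
  run c (v ∷ σ) = run (fire c v) σ

  Fires : Config n → List (Fin n) → Config n → Set
  Fires c σ d = Legal c σ × run c σ ≗ d

  Legal-≗ : ∀ {c c′} σ → c ≗ c′ → Legal c σ → Legal c′ σ
  Legal-≗ []      c≗c′ _        = tt
  Legal-≗ (v ∷ σ) c≗c′ (lv , L) = subst (outdeg v ≤_) (c≗c′ v) lv , Legal-≗ σ (fire-≗ v c≗c′) L

  run-≗ : ∀ {c c′} σ → c ≗ c′ → run c σ ≗ run c′ σ
  run-≗ []      c≗c′ = c≗c′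
  run-≗ (v ∷ σ) c≗c′ = run-≗ σ (fire-≗ v c≗c′)

  Fires-≗ : ∀ {c c′ d} σ → c ≗ c′ → Fires c σ d → Fires c′ σ d
  Fires-≗ σ c≗c′ (L , end) = Legal-≗ σ c≗c′ L , λ x → trans (sym (run-≗ σ c≗c′ x)) (end x)

  Fires-++ : ∀ {c d e} α {β} → Fires c α d → Fires d β e → Fires c (α ++ β) e
  Fires-++ []      {β} (_ , c≗d)        Fβ = Fires-≗ β (sym ∘ c≗d) Fβ
  Fires-++ (v ∷ α)     ((lv , Lα) , end) Fβ =
    let (L , end′) = Fires-++ α (Lα , end) Fβ in (lv , L) , end′

  Fires-⊕ : ∀ {c d} σ a → Fires c σ d → Fires (c ⊕ a) σ (d ⊕ a)
  Fires-⊕ []      a (_ , c≗d) = tt , λ x → cong (_+ a x) (c≗d x)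
  Fires-⊕ (v ∷ σ) a ((lv , L) , end) =
    let (L′ , end′) = Fires-≗ σ (sym ∘ fire-⊕ a lv) (Fires-⊕ σ a (L , end))
    in (≤-trans lv (m≤m+n _ _) , L′) , end′

  run-≥ : ∀ {c w} σ → w ∉ σ → c w ≤ run c σ w
  run-≥ []      w∉σ = ≤-refl
  run-≥ {c} (v ∷ σ) w∉σ = ≤-trans (fire-≥ c (w∉σ ∘ here)) (run-≥ σ (w∉σ ∘ there))

  run-≥-edge : ∀ {c u v} σ → v ∉ σ → u ∈ σ → c v + E u v ≤ run c σ v
  run-≥-edge {c} {v = v} (u ∷ σ) v∉σ (here refl) =
    subst (_≤ run (fire c u) σ v) (fire-≢ c (v∉σ ∘ here)) (run-≥ σ (v∉σ ∘ there))
  run-≥-edge {c} (w ∷ σ) v∉σ (there u∈σ) =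
    ≤-trans (+-monoˡ-≤ _ (fire-≥ c (v∉σ ∘ here))) (run-≥-edge σ (v∉σ ∘ there) u∈σ)

  Σall-run : ∀ {c} σ → Legal c σ → Σall (run c σ) ≡ Σall c
  Σall-run []      _        = refl
  Σall-run (v ∷ σ) (lv , L) = trans (Σall-run σ L) (Σall-fire lv)

  ∈-splitFirst : ∀ {w σ} → w ∈ σ → ∃₂ λ (σ₁ σ₂ : List (Fin n)) → σ ≡ σ₁ ++ w ∷ σ₂ × w ∉ σ₁
  ∈-splitFirst {w} {x ∷ σ} w∈ with x ≟ w
  ... | yes refl = [] , σ , refl , λ ()
  ... | no x≢w with w∈
  ...   | here w≡x  = ⊥-elim (x≢w (sym w≡x))
  ...   | there w∈σ = let (σ₁ , σ₂ , σ≡ , w∉σ₁) = ∈-splitFirst w∈σ in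
    x ∷ σ₁ , σ₂ , cong (x ∷_) σ≡ , λ { (here w≡x) → x≢w (sym w≡x) ; (there w∈σ₁) → w∉σ₁ w∈σ₁ }

  move-to-front : ∀ {c d w} σ₁ {σ₂} → w ∉ σ₁ → outdeg w ≤ c w →
                  Fires c (σ₁ ++ w ∷ σ₂) d → Fires (fire c w) (σ₁ ++ σ₂) d
  move-to-front []       _     _  ((_ , L) , end) = L , end
  move-to-front {c} {w = w} (u ∷ σ₁) {σ₂} w∉ lw ((lu , L) , end) =
    let u≢w = λ u≡w → w∉ (here (sym u≡w))
        (L′ , end′) = move-to-front σ₁ (w∉ ∘ there) (≤-trans lw (fire-≥ c (u≢w ∘ sym))) (L , end)
    in (≤-trans lu (fire-≥ c u≢w) , Legal-≗ (σ₁ ++ σ₂) (fire-comm lu lw) L′) ,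
       λ x → trans (sym (run-≗ (σ₁ ++ σ₂) (fire-comm lu lw) x)) (end′ x)

  fire-first : ∀ {c d w σ} → w ∈ σ → outdeg w ≤ c w → Fires c σ d →
               ∃ λ σ′ → σ ↭ w ∷ σ′ × Fires (fire c w) σ′ d
  fire-first {w = w} w∈σ lw F with ∈-splitFirst w∈σ
  ... | σ₁ , σ₂ , refl , w∉σ₁ = σ₁ ++ σ₂ , shift w σ₁ σ₂ , move-to-front σ₁ w∉σ₁ lw F

  Reach⇒Fires : ∀ {c d} → Reach c d → ∃ λ σ → Fires c σ d
  Reach⇒Fires ε = [] , tt , λ _ → refl
  Reach⇒Fires ((v , lv , d≗) ◅ rest) =
    let (σ , L , end) = Reach⇒Fires rest
    in v ∷ σ , (lv , Legal-≗ σ d≗ L) , λ x → trans (run-≗ σ (sym ∘ d≗) x) (end x)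

  Fires⇒Reach : ∀ {c d} σ → 0 < length σ → Fires c σ d → Reach c d
  Fires⇒Reach (v ∷ [])    _ ((lv , _) , end) = (v , lv , sym ∘ end) ◅ ε
  Fires⇒Reach (v ∷ u ∷ σ) _ ((lv , L) , end) =
    (v , lv , λ _ → refl) ◅ Fires⇒Reach (u ∷ σ) (s≤s z≤n) (L , end)

  Legal⇒Unstable : ∀ {c} σ → 0 < length σ → Legal c σ → Unstable c
  Legal⇒Unstable (v ∷ _) _ (lv , _) = v , lv

  Unstable-back : ∀ {y z} → Unstable y → Reach z y → Unstable z
  Unstable-back y-unstable ε              = y-unstable
  Unstable-back _          ((v , lv , _) ◅ _) = v , lv

  Recurrent-reach : ∀ {y z} → Recurrent y → Reach y z → Recurrent z
  Recurrent-reach {z = z} (y-unstable , back) y↝z =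
    Unstable-back y-unstable (back z y↝z) , λ d z↝d → back d (y↝z ◅◅ z↝d) ◅◅ y↝z

  Recurrent-run : ∀ {y} σ → Recurrent y → Legal y σ → Recurrent (run y σ)
  Recurrent-run []      rec _        = rec
  Recurrent-run (v ∷ σ) rec (lv , L) =
    Recurrent-run σ (Recurrent-reach rec ((v , lv , λ _ → refl) ◅ ε)) L

  module _ (SC : StronglyConnected) {x : Config n} {τ : List (Fin n)}
           (0<τ : 0 < length τ) (cycle : Fires x τ x) where

    -- x returns to itself, so no chip can leave the set of vertices fired in τ.
    no-edge-out : ∀ {u v} → u ∈ τ → v ∉ τ → E u v ≡ 0
    no-edge-out {u} {v} u∈τ v∉τ = n≤0⇒n≡0 (+-cancelˡ-≤ (x v) (E u v) 0
      (subst (x v + E u v ≤_) (trans (proj₂ cycle v) (sym (+-identityʳ (x v)))) (run-≥-edge τ v∉τ u∈τ)))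

    Path-∈ : ∀ {u v} → Path u v → u ∈ τ → v ∈ τ
    Path-∈ here u∈τ = u∈τ
    Path-∈ (there {w = w} 0<E p) u∈τ with w ∈? τ
    ... | yes w∈τ = Path-∈ p w∈τ
    ... | no  w∉τ = ⊥-elim (<⇒≱ 0<E (≤-reflexive (no-edge-out u∈τ w∉τ)))

    all-fire : ∀ v → v ∈ τ
    all-fire v = let (u , u∈τ) = nonempty-∈ 0<τ in Path-∈ (SC u v) u∈τ

    -- Any firing can be absorbed into a route back to x after appending one more copy of τ,
    -- since τ fires every vertex.
    catch-up : ∀ α {y} ρ → Legal y α → Fires y ρ x → ∃ λ γ → Fires (run y α) γ x
    catch-up []      ρ _        F = ρ , F
    catch-up (w ∷ α) ρ (lw , L) F =
      let (ρ′ , _ , F′) = fire-first (∈-++⁺ʳ ρ (all-fire w)) lw (Fires-++ ρ F cycle)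
      in catch-up α ρ′ L F′

    cycle⇒Recurrent : Recurrent x
    cycle⇒Recurrent = Legal⇒Unstable τ 0<τ (proj₁ cycle) , λ d x↝d →
      let (α , Lα , end) = Reach⇒Fires x↝d
          (γ , Fγ) = catch-up α [] Lα (tt , λ _ → refl)
          0<γτ = subst (0 <_) (sym (length-++ γ)) (≤-trans 0<τ (m≤n+m _ _))
      in Fires⇒Reach (γ ++ τ) 0<γτ (Fires-++ γ (Fires-≗ γ end Fγ) cycle)

module WithSink {n : ℕ} (E : Fin n → Fin n → ℕ) (s : Fin n) where
  open Firing E public
  open DecMembership (_≟_ {n}) using (_∈?_)

  _≈_ : Config n → Config n → Set
  a ≈ b = a ≈[ s ] b

  ≈-setoid : Setoid 0ℓ 0ℓ
  ≈-setoid = record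
    { Carrier       = Config n
    ; _≈_           = _≈_
    ; isEquivalence = record
      { refl  = λ _ _ → refl
      ; sym   = λ a≈b v v≢s → sym (a≈b v v≢s)
      ; trans = λ a≈b b≈c v v≢s → trans (a≈b v v≢s) (b≈c v v≢s)
      }
    }

  open Setoid ≈-setoid public using () renaming (refl to ≈-refl; sym to ≈-sym; trans to ≈-trans)

  ≗⇒≈ : ∀ {a b} → a ≗ b → a ≈ b
  ≗⇒≈ a≗b v _ = a≗b v

  ⊕-≈ : ∀ {a b} d → a ≈ b → (a ⊕ d) ≈ (b ⊕ d)
  ⊕-≈ d a≈b v v≢s = cong (_+ d v) (a≈b v v≢s)

  fire-≈ : ∀ v {a b} → a ≈ b → fire a v ≈ fire b v
  fire-≈ v a≈b x x≢s = cong (λ z → z ∸ δ v (outdeg v) x + E v x) (a≈b x x≢s)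

  NonSink : List (Fin n) → Set
  NonSink = All (_≢ s)

  Legal-≈ : ∀ {a b} σ → NonSink σ → a ≈ b → Legal a σ → Legal b σ
  Legal-≈ []      _            _   _        = tt
  Legal-≈ (v ∷ σ) (v≢s ∷ nσ) a≈b (lv , L) =
    subst (outdeg v ≤_) (a≈b v v≢s) lv , Legal-≈ σ nσ (fire-≈ v a≈b) L

  run-≈ : ∀ {a b} σ → a ≈ b → run a σ ≈ run b σ
  run-≈ []      a≈b = a≈b
  run-≈ (v ∷ σ) a≈b = run-≈ σ (fire-≈ v a≈b)

  SStable-≈ : ∀ {a b} → a ≈ b → SStable s a → SStable s b
  SStable-≈ a≈b st v v≢s = subst (_< outdeg v) (a≈b v v≢s) (st v v≢s)

  Σoff-≈ : ∀ {a b} → a ≈ b → Σoff s a ≡ Σoff s b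
  Σoff-≈ {a} {b} a≈b = Σall-cong off
    where
    off : ∀ x → (if does (x ≟ s) then 0 else a x) ≡ (if does (x ≟ s) then 0 else b x)
    off x with x ≟ s
    ... | yes _   = refl
    ... | no  x≢s = a≈b x x≢s

  dlvl-≈ : ∀ {a b} → a ≈ b → dlvl s a ≡ dlvl s b
  dlvl-≈ a≈b = cong (outdeg s +_) (Σoff-≈ a≈b)

  extAdd-≈ : ∀ a m → extAdd s a m ≈ a
  extAdd-≈ a m x x≢s with x ≟ s
  ... | yes x≡s = ⊥-elim (x≢s x≡s)
  ... | no  _   = refl

  extAdd-s : ∀ a m → extAdd s a m s ≡ m
  extAdd-s a m with s ≟ s
  ... | yes _   = refl
  ... | no  s≢s = ⊥-elim (s≢s refl)

  Σall-extAdd : ∀ a m → Σall (extAdd s a m) ≡ m + Σoff s a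
  Σall-extAdd a m = trans (Σall-split s _) (cong₂ _+_ (extAdd-s a m) (Σoff-≈ (extAdd-≈ a m)))

  SUnstable : Config n → Set
  SUnstable a = ∃ λ w → w ≢ s × outdeg w ≤ a w

  sunstable? : (a : Config n) → Dec (SUnstable a)
  sunstable? a = any? λ w → ¬? (w ≟ s) ×-dec (outdeg w ≤? a w)

  ¬SUnstable⇒SStable : ∀ {a} → ¬ SUnstable a → SStable s a
  ¬SUnstable⇒SStable ¬u v v≢s = ≰⇒> λ lv → ¬u (v , v≢s , lv)

  SStable-Recurrent⇒sink-unstable : ∀ {y} → SStable s y → Recurrent y → outdeg s ≤ y s
  SStable-Recurrent⇒sink-unstable st ((v , lv) , _) with v ≟ s
  ... | yes refl = lv
  ... | no  v≢s  = ⊥-elim (<⇒≱ (st v v≢s) lv)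

  -- An unstable vertex only gains chips until it fires.
  unstable-fires : ∀ {a w} σ → w ≢ s → outdeg w ≤ a w → SStable s (run a σ) → w ∈ σ
  unstable-fires {w = w} σ w≢s lw st with w ∈? σ
  ... | yes w∈σ = w∈σ
  ... | no  w∉σ = ⊥-elim (<⇒≱ (st w w≢s) (≤-trans lw (run-≥ σ w∉σ)))

  SStable-stuck : ∀ {a} σ → NonSink σ → SStable s a → Legal a σ → σ ≡ []
  SStable-stuck []      _          _  _        = refl
  SStable-stuck (v ∷ _) (v≢s ∷ _) st (lv , _) = ⊥-elim (<⇒≱ (st v v≢s) lv)

  Stabilizing : Config n → List (Fin n) → Set
  Stabilizing a σ = NonSink σ × Legal a σ × SStable s (run a σ)

  exchange : ∀ {a} β σ → NonSink β → Legal a β → Stabilizing a σ →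
             ∃ λ γ → NonSink γ × Fires (run a β) γ (run a σ) × length β + length γ ≡ length σ
  exchange []      σ _          _         (nσ , Lσ , _)  = σ , nσ , (Lσ , λ _ → refl) , refl
  exchange (w ∷ β) σ (w≢s ∷ nβ) (lw , Lβ) (nσ , Lσ , st) =
    let (σ′ , σ↭ , L′ , end′) = fire-first (unstable-fires σ w≢s lw st) lw (Lσ , λ _ → refl)
        st′ = SStable-≈ (≗⇒≈ (sym ∘ end′)) st
        (γ , nγ , (Lγ , endγ) , len) = exchange β σ′ nβ Lβ (All-tail (All-resp-↭ σ↭ nσ) , L′ , st′)
    in γ , nγ , (Lγ , λ x → trans (endγ x) (end′ x)) , trans (cong suc len) (sym (↭-length σ↭))

  stabilization-unique : ∀ {a β σ} → Stabilizing a β → Stabilizing a σ → run a β ≗ run a σ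
  stabilization-unique {β = β} {σ} (nβ , Lβ , stβ) Sσ with exchange β σ nβ Lβ Sσ
  ... | γ , nγ , (Lγ , end) , _ with SStable-stuck γ nγ stβ Lγ
  ...   | refl = end

  stabilization-shortest : ∀ {a} β {σ} → NonSink β → Legal a β → Stabilizing a σ → length β ≤ length σ
  stabilization-shortest β {σ} nβ Lβ Sσ =
    let (γ , _ , _ , len) = exchange β σ nβ Lβ Sσ in subst (length β ≤_) len (m≤m+n _ _)

  SReach⇒run : ∀ {a e} → SReach s a e → ∃ λ σ → NonSink σ × Legal a σ × run a σ ≈ e
  SReach⇒run ε = [] , [] , tt , ≈-refl
  SReach⇒run ((v , v≢s , lv , d≈) ◅ rest) =
    let (σ , nσ , L , end) = SReach⇒run rest
    in v ∷ σ , v≢s ∷ nσ , (lv , Legal-≈ σ nσ d≈ L) , ≈-trans (run-≈ σ (≈-sym d≈)) end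

  run⇒SReach : ∀ {a} σ → NonSink σ → Legal a σ → SReach s a (run a σ)
  run⇒SReach []      _            _        = ε
  run⇒SReach (v ∷ σ) (v≢s ∷ nσ) (lv , L) = (v , v≢s , lv , ≈-refl) ◅ run⇒SReach σ nσ L

  Stab⇒Stabilizing : ∀ {a d} → Stab s a d → ∃ λ σ → Stabilizing a σ × run a σ ≈ d
  Stab⇒Stabilizing (e , a↝e , st , e≈d) =
    let (σ , nσ , L , end) = SReach⇒run a↝e
    in σ , (nσ , L , SStable-≈ (≈-sym end) st) , ≈-trans end e≈d

  Fires⇒Stab : ∀ {a e d} σ → NonSink σ → Fires a σ e → SStable s e → e ≈ d → Stab s a d
  Fires⇒Stab σ nσ (L , end) st e≈d =
    _ , run⇒SReach σ nσ L , SStable-≈ (≗⇒≈ (sym ∘ end)) st , ≈-trans (≗⇒≈ end) e≈d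

  Stab-SStable : ∀ {a d} → Stab s a d → SStable s d
  Stab-SStable (_ , _ , st , e≈d) = SStable-≈ e≈d st

  Stab-unique : ∀ {a d d′} → Stab s a d → Stab s a d′ → d ≈ d′
  Stab-unique a∼d a∼d′ =
    let (β , Sβ , β-end) = Stab⇒Stabilizing a∼d
        (σ , Sσ , σ-end) = Stab⇒Stabilizing a∼d′
    in ≈-trans (≈-sym β-end) (≈-trans (≗⇒≈ (stabilization-unique Sβ Sσ)) σ-end)

  Stab-≈ : ∀ {a a′ d} → a ≈ a′ → Stab s a d → Stab s a′ d
  Stab-≈ a≈a′ a∼d =
    let (σ , (nσ , L , st) , end) = Stab⇒Stabilizing a∼d
    in Fires⇒Stab σ nσ (Legal-≈ σ nσ a≈a′ L , λ _ → refl) (SStable-≈ (run-≈ σ a≈a′) st)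
         (≈-trans (≈-sym (run-≈ σ a≈a′)) end)

  Stab-⊕ : ∀ {a b d e} → Stab s a b → Stab s (b ⊕ d) e → Stab s (a ⊕ d) e
  Stab-⊕ {a} {b} {d} a∼b b⊕d∼e =
    let (σ , (nσ , Lσ , _) , σ-end) = Stab⇒Stabilizing a∼b
        (τ , (nτ , Lτ , stτ) , τ-end) = Stab⇒Stabilizing b⊕d∼e
        σ-end⊕ = ⊕-≈ d σ-end
    in Fires⇒Stab (σ ++ τ) (All-++⁺ nσ nτ)
         (Fires-++ σ (Fires-⊕ σ d (Lσ , λ _ → refl)) (Legal-≈ τ nτ (≈-sym σ-end⊕) Lτ , λ _ → refl))
         (SStable-≈ (run-≈ τ (≈-sym σ-end⊕)) stτ) (≈-trans (run-≈ τ σ-end⊕) τ-end)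

  greedy : ∀ fuel a → (∃ λ σ → Stabilizing a σ) ⊎ (∃ λ σ → NonSink σ × Legal a σ × length σ ≡ fuel)
  greedy zero    a = inj₂ ([] , [] , tt , refl)
  greedy (suc f) a with sunstable? a
  ... | no ¬u = inj₁ ([] , [] , tt , ¬SUnstable⇒SStable ¬u)
  ... | yes (w , w≢s , lw) with greedy f (fire a w)
  ...   | inj₁ (σ , nσ , L , st)  = inj₁ (w ∷ σ , w≢s ∷ nσ , (lw , L) , st)
  ...   | inj₂ (σ , nσ , L , len) = inj₂ (w ∷ σ , w≢s ∷ nσ , (lw , L) , cong suc len)

  -- Any legal sequence from a is legal from a ⊕ b, so by the least action principle
  -- greedy firing from a stops within the length of a stabilization of a ⊕ b.
  Stab-⊕⁻ : ∀ {a b e} → Stab s (a ⊕ b) e → ∃ (Stab s a)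
  Stab-⊕⁻ {a} {b} a⊕b∼e with Stab⇒Stabilizing a⊕b∼e
  ... | σ , Sσ , _ with greedy (suc (length σ)) a
  ...   | inj₁ (β , nβ , Lβ , st) = run a β , Fires⇒Stab β nβ (Lβ , λ _ → refl) st ≈-refl
  ...   | inj₂ (β , nβ , Lβ , len) = ⊥-elim (<⇒≱ (≤-reflexive (sym len))
            (stabilization-shortest β nβ (proj₁ (Fires-⊕ β b (Lβ , λ _ → refl))) Sσ))

  fillSink : ℕ → Config n → Config n
  fillSink M a = extAdd s a (M ∸ Σoff s a)

  fillSink-≈ : ∀ M {a b} → a ≈ b → fillSink M a ≗ fillSink M b
  fillSink-≈ M {a} {b} a≈b x with x ≟ s
  ... | yes _   = cong (M ∸_) (Σoff-≈ a≈b)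
  ... | no  x≢s = a≈b x x≢s

  ≈-Σall⇒≗fillSink : ∀ {d a M} → d ≈ a → Σall d ≡ M → d ≗ fillSink M a
  ≈-Σall⇒≗fillSink {d} {a} {M} d≈a total x with x ≟ s
  ... | no  x≢s = d≈a x x≢s
  ... | yes refl = begin
    d s                          ≡⟨ m+n∸n≡m (d s) (Σoff s a) ⟨
    d s + Σoff s a ∸ Σoff s a    ≡⟨ cong (λ m → d s + m ∸ Σoff s a) (Σoff-≈ d≈a) ⟨
    d s + Σoff s d ∸ Σoff s a    ≡⟨ cong (_∸ Σoff s a) (trans (sym (Σall-split s d)) total) ⟩
    M ∸ Σoff s a                 ∎
    where open ≡-Reasoning

  ku-+ : ∀ a j k → ((a ⊕ ku s j) ⊕ ku s k) ≗ (a ⊕ ku s (j + k))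
  ku-+ a j k x = trans (+-assoc (a x) _ _) (cong (a x +_) (sym (*-distribʳ-+ (E s x) j k)))

  fire-sink-≈ : ∀ {y a} → y ≈ a → fire y s ≈ (a ⊕ ku s 1)
  fire-sink-≈ {y} y≈a x x≢s =
    trans (fire-≢ y x≢s) (cong₂ _+_ (y≈a x x≢s) (sym (+-identityʳ (E s x))))

  -- L is fuel: every step either lowers k or shortens σ.
  mimic-stabilization : ∀ k L {y a d σ} → length σ < L → Recurrent y → y ≈ a → NonSink σ →
                        Fires (a ⊕ ku s k) σ d → SStable s d → ∃ λ ρ → Legal y ρ × run y ρ ≈ d
  mimic-stabilization k (suc L) {y} {a} {σ = σ} len rec y≈a nσ F st with sunstable? y
  ... | yes (w , w≢s , lw) =
    let law = subst (outdeg w ≤_) (y≈a w w≢s) lw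
        law⊕ = ≤-trans law (m≤m+n (a w) (ku s k w))
        w∈σ = unstable-fires σ w≢s law⊕ (SStable-≈ (≗⇒≈ (sym ∘ proj₂ F)) st)
        (σ′ , σ↭ , F′) = fire-first w∈σ law⊕ F
        len′ = ≤-pred (subst (λ m → suc m ≤ suc L) (↭-length σ↭) len)
        (ρ , Lρ , end) = mimic-stabilization k L len′
                           (Recurrent-run (w ∷ []) rec (lw , tt)) (fire-≈ w y≈a)
                           (All-tail (All-resp-↭ σ↭ nσ)) (Fires-≗ σ′ (fire-⊕ (ku s k) law) F′) st
    in w ∷ ρ , (lw , Lρ) , end
  mimic-stabilization zero (suc L) {a = a} {σ = σ} len rec y≈a nσ (Lσ , end) st | no ¬u
    with SStable-stuck σ nσ (SStable-≈ (λ x x≢s → trans (y≈a x x≢s) (sym (+-identityʳ (a x))))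
                                       (¬SUnstable⇒SStable ¬u)) Lσ
  ... | refl = [] , tt , λ x x≢s → trans (y≈a x x≢s) (trans (sym (+-identityʳ (a x))) (end x))
  mimic-stabilization (suc k) (suc L) {a = a} {σ = σ} len rec y≈a nσ F st | no ¬u =
    let ls = SStable-Recurrent⇒sink-unstable (¬SUnstable⇒SStable ¬u) rec
        (ρ , Lρ , end) = mimic-stabilization k (suc (length σ)) ≤-refl
                           (Recurrent-run (s ∷ []) rec (ls , tt)) (fire-sink-≈ y≈a) nσ
                           (Fires-≗ σ (sym ∘ ku-+ a 1 k) F) st
    in s ∷ ρ , (ls , Lρ) , end

  dlvl-bound : ∀ {c j d} → Recurrent (extAdd s c j) → Equiv s c d → dlvl s d ≤ j + Σoff s c
  dlvl-bound {c} {j} {d} rec (k , c⊕ku∼d) =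
    let (σ , (nσ , Lσ , stσ) , σ-end) = Stab⇒Stabilizing c⊕ku∼d
        (ρ , Lρ , ρ-end) = mimic-stabilization k (suc (length σ)) ≤-refl rec (extAdd-≈ c j) nσ
                             (Lσ , λ _ → refl) stσ
        w = run (extAdd s c j) ρ
        w≈d = ≈-trans ρ-end σ-end
        ls = SStable-Recurrent⇒sink-unstable (SStable-≈ (≈-sym w≈d) (Stab-SStable c⊕ku∼d))
                                              (Recurrent-run ρ rec Lρ)
        total : w s + Σoff s d ≡ j + Σoff s c
        total = begin
          w s + Σoff s d            ≡⟨ cong (w s +_) (Σoff-≈ w≈d) ⟨
          w s + Σoff s w            ≡⟨ Σall-split s w ⟨
          Σall w                    ≡⟨ Σall-run ρ Lρ ⟩
          Σall (extAdd s c j)       ≡⟨ Σall-extAdd c j ⟩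
          j + Σoff s c              ∎
    in subst (dlvl s d ≤_) total (+-monoˡ-≤ (Σoff s d) ls)
    where open ≡-Reasoning

module Orbit {n : ℕ} (E : Fin n → Fin n → ℕ) (s : Fin n) (c : Config n)
             (SR : Sandpile.SRecurrent E s c) where
  open WithSink E s public

  stab : Config n → Config n
  stab a = proj₁ (Stab-⊕⁻ {b = proj₁ (SR a)} (proj₂ (SR a)))

  stab-Stab : ∀ a → Stab s a (stab a)
  stab-Stab a = proj₂ (Stab-⊕⁻ {b = proj₁ (SR a)} (proj₂ (SR a)))

  T : Config n → Config n
  T a = stab (a ⊕ ku s 1)

  T-≈ : ∀ {a b} → a ≈ b → T a ≈ T b
  T-≈ {a} {b} a≈b =
    Stab-unique (Stab-≈ (⊕-≈ (ku s 1) a≈b) (stab-Stab (a ⊕ ku s 1))) (stab-Stab (b ⊕ ku s 1))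

  orbit : ℕ → Config n → Config n
  orbit k a = fold a T k

  orbit-≈ : ∀ k {a b} → a ≈ b → orbit k a ≈ orbit k b
  orbit-≈ zero    a≈b = a≈b
  orbit-≈ (suc k) a≈b = T-≈ (orbit-≈ k a≈b)

  Stab-orbit : ∀ k {a} → SStable s a → Stab s (a ⊕ ku s k) (orbit k a)
  Stab-orbit zero {a} st = Fires⇒Stab [] [] (tt , λ _ → refl)
    (SStable-≈ (λ x _ → sym (+-identityʳ (a x))) st) (λ x _ → +-identityʳ (a x))
  Stab-orbit (suc k) {a} st =
    Stab-≈ (≗⇒≈ λ x → trans (ku-+ a k 1 x) (cong (λ m → a x + m * E s x) (+-comm k 1)))
           (Stab-⊕ (Stab-orbit k st) (stab-Stab (orbit k a ⊕ ku s 1)))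

  orbit-SStable : ∀ k {a} → SStable s a → SStable s (orbit k a)
  orbit-SStable k st = Stab-SStable (Stab-orbit k st)

  c-SStable : SStable s c
  c-SStable = Stab-SStable (proj₂ (SR (λ _ → 0)))

  Equiv-orbit : ∀ k → Equiv s c (orbit k c)
  Equiv-orbit k = k , Stab-orbit k c-SStable

  -- Stable configurations are encoded injectively in Fin (B ^ n): the digit at v is the
  -- number of chips at v (0 at the sink), which is below outdeg v ≤ Σall outdeg < B.
  B : ℕ
  B = suc (Σall outdeg)

  digit-bound : ∀ {d} → SStable s d → ∀ v → extAdd s d 0 v < B
  digit-bound st v with v ≟ s
  ... | yes _   = s≤s z≤n
  ... | no  v≢s = m≤n⇒m≤1+n (≤-trans (st v v≢s) outdeg≤Σall)
    where outdeg≤Σall = subst (outdeg v ≤_) (sym (Σall-split v outdeg)) (m≤m+n _ _)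

  code : ∀ d → SStable s d → Fin (B ^ n)
  code d st = funToFin λ v → fromℕ< (digit-bound st v)

  code-injective : ∀ {d d′} (st : SStable s d) (st′ : SStable s d′) →
                   code d st ≡ code d′ st′ → d ≈ d′
  code-injective {d} {d′} st st′ eq v v≢s = begin
    d v                                  ≡⟨ extAdd-≈ d 0 v v≢s ⟨
    extAdd s d 0 v                       ≡⟨ toℕ-fromℕ< (digit-bound st v) ⟨
    toℕ (fromℕ< (digit-bound st v))      ≡⟨ cong toℕ same-digit ⟩
    toℕ (fromℕ< (digit-bound st′ v))     ≡⟨ toℕ-fromℕ< (digit-bound st′ v) ⟩
    extAdd s d′ 0 v                      ≡⟨ extAdd-≈ d′ 0 v v≢s ⟩
    d′ v                                 ∎
    where
    open ≡-Reasoning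
    same-digit : fromℕ< (digit-bound st v) ≡ fromℕ< (digit-bound st′ v)
    same-digit = trans (sym (finToFun-funToFin _ v))
                   (trans (cong (λ k → finToFun k v) eq) (finToFun-funToFin _ v))

  orbit-repeats : ∀ {x} → SStable s x → ∃₂ λ i j → i < j × j ≤ B ^ n × orbit i x ≈ orbit j x
  orbit-repeats {x} st =
    let digits : Fin (suc (B ^ n)) → Fin (B ^ n)
        digits i = code (orbit (toℕ i) x) (orbit-SStable (toℕ i) st)
        (i , j , i<j , same) = pigeonhole ≤-refl digits
    in toℕ i , toℕ j , i<j , ≤-pred (toℕ<n j)
     , code-injective (orbit-SStable (toℕ i) st) (orbit-SStable (toℕ j) st) same

  -- c = (c₂ + N·u_s)° = Tᴺ x for x = c₂°, and the pigeonhole repetition Tⁱ x ≈ Tʲ x makes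
  -- the orbit of Tᴺ x periodic with period j ∸ i.
  period : ∃ λ P → 0 < P × orbit P c ≈ c
  period =
    let (c₂ , ku⊕c₂∼c) = SR (ku s N)
        x-st = Stab-SStable (stab-Stab c₂)
        orbit-N≈c : orbit N (stab c₂) ≈ c
        orbit-N≈c = Stab-unique (Stab-≈ (≗⇒≈ λ v → +-comm (c₂ v) _)
                                         (Stab-⊕ (stab-Stab c₂) (Stab-orbit N x-st))) ku⊕c₂∼c
        (i , j , i<j , j≤N , repeat) = orbit-repeats x-st
    in j ∸ i , m<n⇒0<n∸m i<j ,
       periodic (stab c₂) orbit-N≈c (<⇒≤ i<j) (≤-trans (<⇒≤ i<j) j≤N) repeat
    where
    N = B ^ n
    shuffle : ∀ {i j} → i ≤ j → i ≤ N → j ∸ i + N ≡ N ∸ i + j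
    shuffle {i} {j} i≤j i≤N = begin
      j ∸ i + N                      ≡⟨ cong (j ∸ i +_) (m∸n+n≡m i≤N) ⟨
      j ∸ i + (N ∸ i + i)            ≡⟨ x∙yz≈y∙xz (j ∸ i) (N ∸ i) i ⟩
      N ∸ i + (j ∸ i + i)            ≡⟨ cong (N ∸ i +_) (m∸n+n≡m i≤j) ⟩
      N ∸ i + j                      ∎
      where open ≡-Reasoning
    periodic : ∀ x {i j} → orbit N x ≈ c → i ≤ j → i ≤ N → orbit i x ≈ orbit j x →
               orbit (j ∸ i) c ≈ c
    periodic x {i} {j} orbit-N≈c i≤j i≤N repeat = begin
      orbit (j ∸ i) c                  ≈⟨ orbit-≈ (j ∸ i) orbit-N≈c ⟨
      orbit (j ∸ i) (orbit N x)        ≡⟨ fold-+ x T (j ∸ i) ⟨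
      orbit (j ∸ i + N) x              ≡⟨ cong (λ k → orbit k x) (shuffle i≤j i≤N) ⟩
      orbit (N ∸ i + j) x              ≡⟨ fold-+ x T (N ∸ i) ⟩
      orbit (N ∸ i) (orbit j x)        ≈⟨ orbit-≈ (N ∸ i) repeat ⟨
      orbit (N ∸ i) (orbit i x)        ≡⟨ fold-+ x T (N ∸ i) ⟨
      orbit (N ∸ i + i) x              ≡⟨ cong (λ k → orbit k x) (m∸n+n≡m i≤N) ⟩
      orbit N x                        ≈⟨ orbit-N≈c ⟩
      c                                ∎
      where open SetoidReasoning ≈-setoid

  orbit-multiple : ∀ {P x} → orbit P x ≈ x → ∀ q → orbit (q * P) x ≈ x
  orbit-multiple         _  zero    = ≈-refl
  orbit-multiple {P} {x} hP (suc q) =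
    ≈-trans (≗⇒≈ (cong-app (fold-+ x T P))) (≈-trans (orbit-≈ P (orbit-multiple hP q)) hP)

  orbit-mod : ∀ {P x} .{{_ : NonZero P}} → orbit P x ≈ x → ∀ j → orbit j x ≈ orbit (j % P) x
  orbit-mod {P} {x} hP j =
    subst (_≈ orbit (j % P) x) (sym j-split) (orbit-≈ (j % P) (orbit-multiple hP (j / P)))
    where
    j-split : orbit j x ≡ orbit (j % P) (orbit (j / P * P) x)
    j-split = trans (cong (λ k → orbit k x) (m≡m%n+[m/n]*n j P)) (fold-+ x T (j % P))

  orbit-maximum : ∃ λ i → ∀ j → dlvl s (orbit j c) ≤ dlvl s (orbit i c)
  orbit-maximum =
    let (P , 0<P , hP) = period
        level = λ j → dlvl s (orbit j c)
        below = f[xs]≤f[argmax] {f = level} 0 (upTo P)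
        i = argmax level 0 (upTo P)
    in i , λ j →
         subst (_≤ level i) (sym (dlvl-≈ (orbit-mod {{>-nonZero 0<P}} hP j)))
               (All-lookup below (∈-upTo⁺ (m%n<n j P {{>-nonZero 0<P}})))

  fillSink-T : ∀ {M a} → dlvl s a ≤ M →
               ∃ λ ρ → 0 < length ρ × Fires (fillSink M a) ρ (fillSink M (T a))
  fillSink-T {M} {a} a≤M =
    let ls = subst (outdeg s ≤_) (sym (extAdd-s a _)) (m+n≤o⇒m≤o∸n (outdeg s) a≤M)
        fire-s≈ = fire-sink-≈ (extAdd-≈ a (M ∸ Σoff s a))
        (σ , (nσ , Lσ , _) , σ-end) = Stab⇒Stabilizing (stab-Stab (a ⊕ ku s 1))
        Lσ′ = Legal-≈ σ nσ (≈-sym fire-s≈) Lσ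
        total = begin
          Σall (run (fire (fillSink M a) s) σ) ≡⟨ Σall-run σ Lσ′ ⟩
          Σall (fire (fillSink M a) s)         ≡⟨ Σall-fire ls ⟩
          Σall (fillSink M a)                  ≡⟨ Σall-extAdd a _ ⟩
          M ∸ Σoff s a + Σoff s a              ≡⟨ m∸n+n≡m (≤-trans (m≤n+m (Σoff s a) (outdeg s)) a≤M) ⟩
          M                                    ∎
    in s ∷ σ , s≤s z≤n , (ls , Lσ′) , ≈-Σall⇒≗fillSink (≈-trans (run-≈ σ fire-s≈) σ-end) total
    where open ≡-Reasoning

  fillSink-orbit : ∀ K {M a} → (∀ i → i < K → dlvl s (orbit i a) ≤ M) →
                   ∃ λ ρ → K ≤ length ρ × Fires (fillSink M a) ρ (fillSink M (orbit K a))
  fillSink-orbit zero    _     = [] , z≤n , tt , λ _ → refl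
  fillSink-orbit (suc K) bound =
    let (ρ , K≤ρ , F) = fillSink-orbit K λ i i<K → bound i (m<n⇒m<1+n i<K)
        (ρ′ , 0<ρ′ , F′) = fillSink-T (bound K ≤-refl)
        len = subst (suc K ≤_) (sym (length-++ ρ))
                (subst (_≤ length ρ + length ρ′) (+-comm K 1) (+-mono-≤ K≤ρ 0<ρ′))
    in ρ ++ ρ′ , len , Fires-++ ρ F F′

  fillSink-Recurrent : StronglyConnected → ∀ {M} → (∀ j → dlvl s (orbit j c) ≤ M) →
                       Recurrent (fillSink M c)
  fillSink-Recurrent SC {M} bound =
    let (P , 0<P , hP) = period
        (ρ , P≤ρ , Lρ , end) = fillSink-orbit P λ i _ → bound i
    in cycle⇒Recurrent SC (≤-trans 0<P P≤ρ) (Lρ , λ x → trans (end x) (fillSink-≈ M hP x))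

lemma4p3 : ∀ {n : ℕ} (E : Fin n → Fin n → ℕ) (s : Fin n) →
    Sandpile.StronglyConnected E →
    (c : Config n) → Sandpile.SRecurrent E s c →
    ∃[ k ] (Sandpile.IsChi E s c k
    × (∃[ d ] (Sandpile.Equiv E s c d × Sandpile.dlvl E s d ≡ k + Sandpile.Σoff E s c))
    × (∀ d → Sandpile.Equiv E s c d → Sandpile.dlvl E s d ≤ k + Sandpile.Σoff E s c))
lemma4p3 E s SC c SR =
  χ , (recurrent , minimal) , (orbit i c , Equiv-orbit i , sym χ+Σ≡M) , λ d c∼d → dlvl-bound recurrent c∼d
  where
  open Orbit E s c SR
  i = proj₁ orbit-maximum
  M = dlvl s (orbit i c)
  χ = M ∸ Σoff s c
  χ+Σ≡M : χ + Σoff s c ≡ M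
  χ+Σ≡M = m∸n+n≡m (≤-trans (m≤n+m (Σoff s c) (outdeg s)) (proj₂ orbit-maximum 0))
  recurrent : Recurrent (extAdd s c χ)
  recurrent = fillSink-Recurrent SC (proj₂ orbit-maximum)
  minimal : ∀ j → j < χ → ¬ Recurrent (extAdd s c j)
  minimal j j<χ rec = <⇒≱ (subst (j + Σoff s c <_) χ+Σ≡M (+-monoˡ-< (Σoff s c) j<χ))
                          (dlvl-bound rec (Equiv-orbit i))
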